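{- Let $c,d$ be non-negative integers and let $M_2(c,d)(n)$ be the number of pairs $(\lambda,v)$ with $\lambda\vdash n$, $v\in\lambda$, $a_v=c$ and $f_v=d$. Then, as formal power series in $q$, $$\sum_{n=0}^{\infty}M_2(c,d)(n)\,q^n=\frac{q^{c+d+1}}{1-q^{c+d+1}}\cdot\frac{1}{(q)_\infty}.$$
   Context: For an integer partition $\lambda=(\lambda_1\ge\lambda_2\ge\cdots)$ of $n$ (written $\lambda\vdash n$), identify $\lambda$ with its Ferrers diagram, the set of cells $v=[i,j]$ with $i\ge1$, $1\le j\le\lambda_i$. For $v=[i,j]\in\lambda$: arm length $a_v=\lambda_i-j$, left length $f_v=j-1$. Notation: $(q)_\infty=\prod_{k\ge1}(1-q^k)$. -}

module Defs where

open import Data.Nat using (ℕ; zero; suc; _≤_; _≥_; _∸_) renaming (_+_ to _+ℕ_)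
open import Data.Integer using (ℤ; +_; -_; _+_; _*_)
open import Data.List using (List; []; _∷_)
open import Data.Nat.ListAction using (sum)
open import Relation.Nullary using (yes; no)
open import Data.Nat using (_≟_)
open import Data.List.Relation.Unary.All using (All)
open import Data.List.Relation.Unary.Linked using (Linked)
open import Data.Product using (_×_; _,_)
open import Relation.Binary.PropositionalEquality using (_≡_)

IsPartition : ℕ → List ℕ → Set
IsPartition n l = (sum l ≡ n) × All (λ x → 1 ≤ x) l × Linked _≥_ l

-- part l i = λ_i (1-indexed), and 0 for i = 0 or i beyond the length.
part : List ℕ → ℕ → ℕ
part []       _             = 0
part (x ∷ xs) zero          = 0
part (x ∷ xs) (suc zero)    = x
part (x ∷ xs) (suc (suc i)) = part xs (suc i)

_∈D_ : ℕ × ℕ → List ℕ → Set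
(i , j) ∈D l = (1 ≤ i) × (1 ≤ j) × (j ≤ part l i)

armLength : List ℕ → ℕ × ℕ → ℕ
armLength l (i , j) = part l i ∸ j

leftLength : ℕ × ℕ → ℕ
leftLength (i , j) = j ∸ 1

M₂Pair : ℕ → ℕ → ℕ → List ℕ × (ℕ × ℕ) → Set
M₂Pair c d n (l , v) =
  IsPartition n l × v ∈D l × (armLength l v ≡ c) × (leftLength v ≡ d)

Series : Set
Series = ℕ → ℤ

sumTo : ℕ → (ℕ → ℤ) → ℤ
sumTo zero    f = f 0
sumTo (suc n) f = sumTo n f + f (suc n)

_⋆_ : Series → Series → Series
(f ⋆ g) n = sumTo n (λ k → f k * g (n ∸ k))

mono : ℕ → Series
mono m n with m ≟ n
... | yes _ = + 1
... | no  _ = + 0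

one : Series
one = mono 0

oneMinus : ℕ → Series
oneMinus m n = one n + - mono m n

pochFin : ℕ → Series
pochFin zero    = one
pochFin (suc m) = pochFin m ⋆ oneMinus (suc m)

-- (q)_∞ = ∏_{k≥1} (1 - q^k); its q^n coefficient equals that of ∏_{k=1}^{n}.
qInf : Series
qInf n = pochFin n n

-- Put k = c + d + 1.  A cell v with a_v = c and f_v = d is the cell (i, d + 1) of a row i of
-- length k, so M₂(c,d)(n) counts partitions of n with one marked part equal to k; it vanishes for
-- n < k.  Removing a part k gives M₂(c,d)(k + N) = M₂(c,d)(N) + p(N): if the row below the mark
-- also has length k delete that row, otherwise delete the marked row, which was the last one of
-- length k.  Hence (1 - q^k) ∑ M₂(c,d)(n) q^n = q^k ∑ p(n) q^n, and it remains to show Euler's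
-- identity (∑ p(n) q^n) (q)_∞ = 1.  With p_m(N) the number of partitions of N into parts ≤ m, the
-- recursion p_m(N) = p_{m-1}(N) + p_m(N - m) reads (1 - q^m) P_m = P_{m-1}, so P_m ∏_{j≤m} (1 - q^j) = 1;
-- in degrees ≤ m both P_m and the finite product agree with their limits, which gives the identity.

module Submission where

open import Defs
open import Data.Nat using (ℕ; suc) renaming (_+_ to _+ℕ_)
open import Data.Integer using (+_)
open import Data.List using (List; length)
open import Data.Product using (_×_)
open import Data.List.Relation.Unary.Unique.Propositional using (Unique)
open import Data.List.Membership.Propositional using (_∈_)
open import Function.Bundles using (_⇔_)
open import Relation.Binary.PropositionalEquality using (_≡_)

module PowerSeries where

  open import Data.Nat as ℕ using (ℕ; zero; suc; _≤_; _<_; _∸_; z≤n; s≤s)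
  import Data.Nat.Properties as ℕ
  open import Data.Integer using (ℤ; +_; -_; _+_; _-_; _*_)
  import Data.Integer.Properties as ℤ
  open import Data.Integer.Tactic.RingSolver using (solve-∀)
  open import Relation.Binary.PropositionalEquality
  open import Relation.Nullary using (yes; no)
  open import Data.Empty using (⊥-elim)

  open ≡-Reasoning

  sumTo-cong : ∀ n {F G : ℕ → ℤ} → (∀ j → j ≤ n → F j ≡ G j) → sumTo n F ≡ sumTo n G
  sumTo-cong zero    F≡G = F≡G 0 z≤n
  sumTo-cong (suc n) F≡G =
    cong₂ _+_ (sumTo-cong n (λ j j≤n → F≡G j (ℕ.m≤n⇒m≤1+n j≤n))) (F≡G (suc n) ℕ.≤-refl)

  sumTo-zero : ∀ n {F : ℕ → ℤ} → (∀ j → j ≤ n → F j ≡ + 0) → sumTo n F ≡ + 0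
  sumTo-zero zero    F≡0 = F≡0 0 z≤n
  sumTo-zero (suc n) F≡0 =
    cong₂ _+_ (sumTo-zero n (λ j j≤n → F≡0 j (ℕ.m≤n⇒m≤1+n j≤n))) (F≡0 (suc n) ℕ.≤-refl)

  sumTo-suc : ∀ n (F : ℕ → ℤ) → sumTo (suc n) F ≡ F 0 + sumTo n (λ j → F (suc j))
  sumTo-suc zero    F = refl
  sumTo-suc (suc n) F =
    trans (cong (_+ F (suc (suc n))) (sumTo-suc n F)) (ℤ.+-assoc (F 0) _ _)

  sumTo-minus : ∀ n (F G : ℕ → ℤ) → sumTo n (λ j → F j - G j) ≡ sumTo n F - sumTo n G
  sumTo-minus zero    F G = refl
  sumTo-minus (suc n) F G =
    trans (cong (_+ (F (suc n) - G (suc n))) (sumTo-minus n F G))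
          (interchange (sumTo n F) (sumTo n G) (F (suc n)) (G (suc n)))
    where
    interchange : ∀ a b c d → (a - b) + (c - d) ≡ (a + c) - (b + d)
    interchange = solve-∀

  _⊖_ : Series → Series → Series
  (f ⊖ g) n = f n - g n

  ⋆-congˡ : ∀ {f f′} g → f ≗ f′ → f ⋆ g ≗ f′ ⋆ g
  ⋆-congˡ g f≗f′ n = sumTo-cong n (λ j _ → cong (_* g (n ∸ j)) (f≗f′ j))

  ⋆-congʳ : ∀ f {g g′} → g ≗ g′ → f ⋆ g ≗ f ⋆ g′
  ⋆-congʳ f g≗g′ n = sumTo-cong n (λ j _ → cong (f j *_) (g≗g′ (n ∸ j)))

  ⋆-distribˡ-⊖ : ∀ f g h → f ⋆ (g ⊖ h) ≗ (f ⋆ g) ⊖ (f ⋆ h)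
  ⋆-distribˡ-⊖ f g h n =
    trans (sumTo-cong n (λ j _ → distrib (f j) (g (n ∸ j)) (h (n ∸ j)))) (sumTo-minus n _ _)
    where
    distrib : ∀ a b c → a * (b - c) ≡ a * b - a * c
    distrib = solve-∀

  ⋆-distribʳ-⊖ : ∀ f g h → (f ⊖ g) ⋆ h ≗ (f ⋆ h) ⊖ (g ⋆ h)
  ⋆-distribʳ-⊖ f g h n =
    trans (sumTo-cong n (λ j _ → distrib (f j) (g j) (h (n ∸ j)))) (sumTo-minus n _ _)
    where
    distrib : ∀ a b c → (a - b) * c ≡ a * c - b * c
    distrib = solve-∀

  ⋆-identityʳ : ∀ g → g ⋆ one ≗ g
  ⋆-identityʳ g zero    = ℤ.*-identityʳ (g 0)
  ⋆-identityʳ g (suc n) = begin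
    sumTo n (λ j → g j * one (suc n ∸ j)) + g (suc n) * one (n ∸ n)
      ≡⟨ cong₂ _+_ (sumTo-zero n λ j j≤n → trans (cong (λ m → g j * one m) (ℕ.+-∸-assoc 1 j≤n)) (ℤ.*-zeroʳ (g j)))
                   (cong (λ m → g (suc n) * one m) (ℕ.n∸n≡0 n)) ⟩
    + 0 + g (suc n) * + 1
      ≡⟨ trans (ℤ.+-identityˡ _) (ℤ.*-identityʳ (g (suc n))) ⟩
    g (suc n) ∎

  shift : ℕ → Series → Series
  shift zero    f n       = f n
  shift (suc k) f zero    = + 0
  shift (suc k) f (suc n) = shift k f n

  shift-< : ∀ k f {n} → n < k → shift k f n ≡ + 0
  shift-< (suc k) f {zero}  _         = refl
  shift-< (suc k) f {suc n} (s≤s n<k) = shift-< k f n<k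

  shift-≥ : ∀ k f {n} → k ≤ n → shift k f n ≡ f (n ∸ k)
  shift-≥ zero    f         _         = refl
  shift-≥ (suc k) f {suc n} (s≤s k≤n) = shift-≥ k f k≤n

  shift-cong : ∀ k {f g} → f ≗ g → shift k f ≗ shift k g
  shift-cong zero    f≗g n       = f≗g n
  shift-cong (suc k) f≗g zero    = refl
  shift-cong (suc k) f≗g (suc n) = shift-cong k f≗g n

  ⋆-shiftʳ : ∀ k f g → f ⋆ shift k g ≗ shift k (f ⋆ g)
  ⋆-shiftʳ zero    f g n       = refl
  ⋆-shiftʳ (suc k) f g zero    = ℤ.*-zeroʳ (f 0)
  ⋆-shiftʳ (suc k) f g (suc n) = begin
    sumTo n (λ j → f j * shift (suc k) g (suc n ∸ j)) + f (suc n) * shift (suc k) g (n ∸ n)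
      ≡⟨ cong₂ _+_ (sumTo-cong n λ j j≤n → cong (λ m → f j * shift (suc k) g m) (ℕ.+-∸-assoc 1 j≤n))
                   (cong (λ m → f (suc n) * shift (suc k) g m) (ℕ.n∸n≡0 n)) ⟩
    (f ⋆ shift k g) n + f (suc n) * + 0
      ≡⟨ trans (cong (λ x → (f ⋆ shift k g) n + x) (ℤ.*-zeroʳ (f (suc n)))) (ℤ.+-identityʳ _) ⟩
    (f ⋆ shift k g) n
      ≡⟨ ⋆-shiftʳ k f g n ⟩
    shift k (f ⋆ g) n ∎

  ⋆-shiftˡ : ∀ k f g → shift k f ⋆ g ≗ shift k (f ⋆ g)
  ⋆-shiftˡ zero    f g n       = refl
  ⋆-shiftˡ (suc k) f g zero    = refl
  ⋆-shiftˡ (suc k) f g (suc n) = begin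
    (shift (suc k) f ⋆ g) (suc n)   ≡⟨ sumTo-suc n _ ⟩
    + 0 + (shift k f ⋆ g) n         ≡⟨ ℤ.+-identityˡ _ ⟩
    (shift k f ⋆ g) n               ≡⟨ ⋆-shiftˡ k f g n ⟩
    shift k (f ⋆ g) n               ∎

  mono-suc : ∀ k n → mono (suc k) (suc n) ≡ mono k n
  mono-suc k n with suc k ℕ.≟ suc n | k ℕ.≟ n
  ... | yes _    | yes _   = refl
  ... | no  _    | no  _   = refl
  ... | yes k≡n  | no  k≢n = ⊥-elim (k≢n (ℕ.suc-injective k≡n))
  ... | no  k≢n  | yes k≡n = ⊥-elim (k≢n (cong suc k≡n))

  mono≗shift-one : ∀ k → mono k ≗ shift k one
  mono≗shift-one zero    n       = refl
  mono≗shift-one (suc k) zero    = refl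
  mono≗shift-one (suc k) (suc n) = trans (mono-suc k n) (mono≗shift-one k n)

  ⋆-mono : ∀ k g → g ⋆ mono k ≗ shift k g
  ⋆-mono k g n = begin
    (g ⋆ mono k) n        ≡⟨ ⋆-congʳ g (mono≗shift-one k) n ⟩
    (g ⋆ shift k one) n   ≡⟨ ⋆-shiftʳ k g one n ⟩
    shift k (g ⋆ one) n   ≡⟨ shift-cong k (⋆-identityʳ g) n ⟩
    shift k g n           ∎

  ⋆-oneMinus : ∀ k g → g ⋆ oneMinus k ≗ g ⊖ shift k g
  ⋆-oneMinus k g n =
    trans (⋆-distribˡ-⊖ g one (mono k) n) (cong₂ _-_ (⋆-identityʳ g n) (⋆-mono k g n))

  ⋆-oneMinus-< : ∀ k f {n} → n < k → (f ⋆ oneMinus k) n ≡ f n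
  ⋆-oneMinus-< k f {n} n<k = begin
    (f ⋆ oneMinus k) n      ≡⟨ ⋆-oneMinus k f n ⟩
    f n - shift k f n       ≡⟨ cong (λ x → f n - x) (shift-< k f n<k) ⟩
    f n + + 0               ≡⟨ ℤ.+-identityʳ (f n) ⟩
    f n                     ∎

  ⋆-oneMinus-recurrence : ∀ k {f} g → (∀ n → f n ≡ g n + shift k f n) → f ⋆ oneMinus k ≗ g
  ⋆-oneMinus-recurrence k {f} g f≡g+shift n = begin
    (f ⋆ oneMinus k) n                  ≡⟨ ⋆-oneMinus k f n ⟩
    f n - shift k f n                   ≡⟨ cong (_- shift k f n) (f≡g+shift n) ⟩
    (g n + shift k f n) - shift k f n   ≡⟨ cancel (g n) (shift k f n) ⟩
    g n                                 ∎
    where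
    cancel : ∀ a b → (a + b) - b ≡ a
    cancel = solve-∀

  -- Multiplying by 1 - q^k subtracts a shift, which commutes with ⋆ on either side; this is all of
  -- associativity and commutativity of ⋆ that is needed.
  ⋆-oneMinus-comm : ∀ k f g → f ⋆ (g ⋆ oneMinus k) ≗ (f ⋆ oneMinus k) ⋆ g
  ⋆-oneMinus-comm k f g n = begin
    (f ⋆ (g ⋆ oneMinus k)) n            ≡⟨ ⋆-congʳ f (⋆-oneMinus k g) n ⟩
    (f ⋆ (g ⊖ shift k g)) n             ≡⟨ ⋆-distribˡ-⊖ f g (shift k g) n ⟩
    (f ⋆ g) n - (f ⋆ shift k g) n       ≡⟨ cong (λ x → (f ⋆ g) n - x) (trans (⋆-shiftʳ k f g n) (sym (⋆-shiftˡ k f g n))) ⟩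
    (f ⋆ g) n - (shift k f ⋆ g) n       ≡⟨ ⋆-distribʳ-⊖ f (shift k f) g n ⟨
    ((f ⊖ shift k f) ⋆ g) n             ≡⟨ ⋆-congˡ g (⋆-oneMinus k f) n ⟨
    ((f ⋆ oneMinus k) ⋆ g) n            ∎

  diagonal-stable : ∀ {a} {A : Set a} (F : ℕ → ℕ → A)
    → (∀ m t → t ≤ m → F (suc m) t ≡ F m t)
    → ∀ {t m} → t ≤ m → F m t ≡ F t t
  diagonal-stable F step t≤m = go (ℕ.≤⇒≤′ t≤m)
    where
    go : ∀ {t m} → t ℕ.≤′ m → F m t ≡ F t t
    go (ℕ.≤′-reflexive refl) = refl
    go (ℕ.≤′-step t≤′m)      = trans (step _ _ (ℕ.≤′⇒≤ t≤′m)) (go t≤′m)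

  pochFin-stable : ∀ {t m} → t ≤ m → pochFin m t ≡ qInf t
  pochFin-stable = diagonal-stable pochFin
    (λ m t t≤m → ⋆-oneMinus-< (suc m) (pochFin m) (s≤s t≤m))

  module _ (p : ℕ → Series) (p-zero : p 0 ≗ one)
           (p-suc : ∀ m → p (suc m) ⋆ oneMinus (suc m) ≗ p m) where

    ⋆-pochFin : ∀ m → p m ⋆ pochFin m ≗ one
    ⋆-pochFin zero    n = trans (⋆-congˡ one p-zero n) (⋆-identityʳ one n)
    ⋆-pochFin (suc m) n = begin
      (p (suc m) ⋆ (pochFin m ⋆ oneMinus (suc m))) n   ≡⟨ ⋆-oneMinus-comm (suc m) (p (suc m)) (pochFin m) n ⟩
      ((p (suc m) ⋆ oneMinus (suc m)) ⋆ pochFin m) n   ≡⟨ ⋆-congˡ (pochFin m) (p-suc m) n ⟩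
      (p m ⋆ pochFin m) n                              ≡⟨ ⋆-pochFin m n ⟩
      one n                                            ∎

    diagonal⋆qInf : (λ t → p t t) ⋆ qInf ≗ one
    diagonal⋆qInf t = trans
      (sumTo-cong t (λ j j≤t → cong₂ _*_ (sym (p-stable j≤t)) (sym (pochFin-stable (ℕ.m∸n≤m t j)))))
      (⋆-pochFin t t)
      where
      p-stable : ∀ {j m} → j ≤ m → p m j ≡ p j j
      p-stable = diagonal-stable p
        (λ m j j≤m → trans (sym (⋆-oneMinus-< (suc m) (p (suc m)) (s≤s j≤m))) (p-suc m j))

  shift-recurrence : ∀ k (A P : Series)
    → (∀ n → n < k → A n ≡ + 0)
    → (∀ N → A (k ℕ.+ N) ≡ A N + P N)
    → ∀ n → A n ≡ shift k P n + shift k A n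
  shift-recurrence k A P below above n with n ℕ.<? k
  ... | yes n<k = trans (below n n<k) (sym (cong₂ _+_ (shift-< k P n<k) (shift-< k A n<k)))
  ... | no  n≮k = begin
    A n                    ≡⟨ cong A (ℕ.m+[n∸m]≡n k≤n) ⟨
    A (k ℕ.+ (n ∸ k))      ≡⟨ above (n ∸ k) ⟩
    A (n ∸ k) + P (n ∸ k)  ≡⟨ ℤ.+-comm (A (n ∸ k)) (P (n ∸ k)) ⟩
    P (n ∸ k) + A (n ∸ k)  ≡⟨ cong₂ _+_ (shift-≥ k P k≤n) (shift-≥ k A k≤n) ⟨
    shift k P n + shift k A n ∎
    where
    k≤n : k ≤ n
    k≤n = ℕ.≮⇒≥ n≮k

module Counting where

  open import Data.Nat using (_+_)
  open import Data.List using (List; length; map; _++_)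
  open import Data.List.Properties using (length-map; length-++; map-∘; map-id-local)
  open import Data.List.Membership.Propositional using (_∈_)
  open import Data.List.Membership.Propositional.Properties using (∈-map⁺; ∈-map⁻; ∈-++⁺ˡ; ∈-++⁺ʳ; ∈-++⁻)
  open import Data.List.Membership.Propositional.Properties.WithK using (unique∧set⇒bag)
  open import Data.List.Relation.Binary.BagAndSetEquality using (∼bag⇒↭)
  open import Data.List.Relation.Binary.Permutation.Propositional.Properties using (↭-length)
  open import Data.List.Relation.Unary.All as All using ()
  open import Data.List.Relation.Unary.Unique.Propositional using (Unique)
  import Data.List.Relation.Unary.Unique.Propositional.Properties as Unique
  open import Data.Empty using (⊥)
  open import Data.Sum using (_⊎_; inj₁; inj₂)
  open import Data.Sum.Properties using (inj₁-injective; inj₂-injective)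
  open import Data.Product using (_×_; _,_; ∃)
  open import Function.Bundles using (_⇔_; mk⇔)
  open import Relation.Binary.PropositionalEquality

  private variable
    A B : Set

  length-≡-by-members : {xs ys : List A} → Unique xs → Unique ys
    → (∀ {z} → z ∈ xs ⇔ z ∈ ys) → length xs ≡ length ys
  length-≡-by-members xs! ys! same = ↭-length (∼bag⇒↭ (unique∧set⇒bag xs! ys! same))

  length-≡-by-inverses : (f : A → B) (g : B → A) {xs : List A} {ys : List B}
    → Unique xs → Unique ys
    → (∀ {x} → x ∈ xs → f x ∈ ys) → (∀ {y} → y ∈ ys → g y ∈ xs)
    → (∀ {x} → x ∈ xs → g (f x) ≡ x) → (∀ {y} → y ∈ ys → f (g y) ≡ y)
    → length xs ≡ length ys
  length-≡-by-inverses f g {xs} {ys} xs! ys! f∈ g∈ gf fg = begin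
    length xs         ≡⟨ length-map f xs ⟨
    length (map f xs) ≡⟨ length-≡-by-members fxs! ys! (mk⇔ to from) ⟩
    length ys         ∎
    where
    open ≡-Reasoning
    g∘f-id : map g (map f xs) ≡ xs
    g∘f-id = trans (sym (map-∘ xs)) (map-id-local (All.tabulate gf))
    fxs! : Unique (map f xs)
    fxs! = Unique.map⁻ (subst Unique (sym g∘f-id) xs!)
    to : ∀ {y} → y ∈ map f xs → y ∈ ys
    to y∈ with ∈-map⁻ f y∈
    ... | x , x∈ , refl = f∈ x∈
    from : ∀ {y} → y ∈ ys → y ∈ map f xs
    from y∈ = subst (_∈ map f xs) (fg y∈) (∈-map⁺ f (g∈ y∈))

  tagged : List A → List B → List (A ⊎ B)
  tagged xs ys = map inj₁ xs ++ map inj₂ ys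

  length-tagged : (xs : List A) (ys : List B) → length (tagged xs ys) ≡ length xs + length ys
  length-tagged xs ys =
    trans (length-++ (map inj₁ xs)) (cong₂ _+_ (length-map inj₁ xs) (length-map inj₂ ys))

  tagged-unique : {xs : List A} {ys : List B} → Unique xs → Unique ys → Unique (tagged xs ys)
  tagged-unique xs! ys! =
    Unique.++⁺ (Unique.map⁺ inj₁-injective xs!) (Unique.map⁺ inj₂-injective ys!) disjoint
    where
    disjoint : ∀ {v} → v ∈ map inj₁ _ × v ∈ map inj₂ _ → ⊥
    disjoint (p , q) with ∈-map⁻ inj₁ p | ∈-map⁻ inj₂ q
    ... | _ , _ , refl | _ , _ , ()

  inj₁∈tagged : {xs : List A} {x : A} (ys : List B) → x ∈ xs → inj₁ x ∈ tagged xs ys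
  inj₁∈tagged ys x∈ = ∈-++⁺ˡ (∈-map⁺ inj₁ x∈)

  inj₂∈tagged : (xs : List A) {ys : List B} {y : B} → y ∈ ys → inj₂ y ∈ tagged xs ys
  inj₂∈tagged xs y∈ = ∈-++⁺ʳ (map inj₁ xs) (∈-map⁺ inj₂ y∈)

  ∈-tagged⁻ : (xs : List A) (ys : List B) {z : A ⊎ B} → z ∈ tagged xs ys
    → (∃ λ x → z ≡ inj₁ x × x ∈ xs) ⊎ (∃ λ y → z ≡ inj₂ y × y ∈ ys)
  ∈-tagged⁻ xs ys z∈ with ∈-++⁻ (map inj₁ xs) z∈
  ... | inj₁ p with ∈-map⁻ inj₁ p
  ...   | x , x∈ , refl = inj₁ (x , refl , x∈)
  ∈-tagged⁻ xs ys z∈ | inj₂ q with ∈-map⁻ inj₂ q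
  ...   | y , y∈ , refl = inj₂ (y , refl , y∈)

module Rows where

  open import Data.Nat as ℕ using (ℕ; zero; suc; _+_; _≤_; _<_; _≥_; z≤n; s≤s; _≤?_)
  import Data.Nat.Properties as ℕ
  open import Data.Nat.ListAction using (sum)
  open import Algebra.Properties.CommutativeSemigroup ℕ.+-commutativeSemigroup using (x∙yz≈y∙xz)
  open import Data.List using (List; []; _∷_; length)
  open import Data.List.Relation.Unary.All as All using (All; []; _∷_)
  open import Data.List.Relation.Unary.Linked as Linked using (Linked; []; [-]; _∷_)
  open import Data.List.Relation.Unary.Linked.Properties using (Linked⇒All)
  open import Relation.Binary.PropositionalEquality
  open import Relation.Nullary using (yes; no)
  open import Data.Empty using (⊥-elim)
  open import Function using (flip)
  open import Data.Product using (_,_)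

  private variable
    A : Set
    x y k : ℕ
    l : List ℕ

  -- Rows are indexed from 0 here: row l i is λ_{i+1}.
  row : List ℕ → ℕ → ℕ
  row l i = part l (suc i)

  deleteAt : ℕ → List A → List A
  deleteAt _       []       = []
  deleteAt zero    (x ∷ xs) = xs
  deleteAt (suc i) (x ∷ xs) = x ∷ deleteAt i xs

  insertAt : ℕ → A → List A → List A
  insertAt zero    y xs       = y ∷ xs
  insertAt (suc i) y []       = y ∷ []
  insertAt (suc i) y (x ∷ xs) = x ∷ insertAt i y xs

  All-deleteAt : ∀ {P : A → Set} i {xs} → All P xs → All P (deleteAt i xs)
  All-deleteAt i       []         = []
  All-deleteAt zero    (_  ∷ pxs) = pxs
  All-deleteAt (suc i) (px ∷ pxs) = px ∷ All-deleteAt i pxs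

  All-insertAt : ∀ {P : A → Set} i {y xs} → P y → All P xs → All P (insertAt i y xs)
  All-insertAt zero    py pxs        = py ∷ pxs
  All-insertAt (suc i) py []         = py ∷ []
  All-insertAt (suc i) py (px ∷ pxs) = px ∷ All-insertAt i py pxs

  deleteAt-insertAt : ∀ i (y : A) xs → i ≤ length xs → deleteAt i (insertAt i y xs) ≡ xs
  deleteAt-insertAt zero    y xs       _         = refl
  deleteAt-insertAt (suc i) y (x ∷ xs) (s≤s i≤n) = cong (x ∷_) (deleteAt-insertAt i y xs i≤n)

  insertAt-deleteAt : ∀ i l → 1 ≤ y → row l i ≡ y → insertAt i y (deleteAt i l) ≡ l
  insertAt-deleteAt i       []       () refl
  insertAt-deleteAt zero    (x ∷ xs) _  x≡y = cong (_∷ xs) (sym x≡y)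
  insertAt-deleteAt (suc i) (x ∷ xs) y>0 eq = cong (x ∷_) (insertAt-deleteAt i xs y>0 eq)

  sum-deleteAt : ∀ i l → sum l ≡ row l i + sum (deleteAt i l)
  sum-deleteAt i       []       = refl
  sum-deleteAt zero    (x ∷ xs) = refl
  sum-deleteAt (suc i) (x ∷ xs) =
    trans (cong (λ s → x + s) (sum-deleteAt i xs)) (x∙yz≈y∙xz x (row xs i) _)

  sum-insertAt : ∀ i y l → sum (insertAt i y l) ≡ y + sum l
  sum-insertAt zero    y l        = refl
  sum-insertAt (suc i) y []       = refl
  sum-insertAt (suc i) y (x ∷ xs) =
    trans (cong (λ s → x + s) (sum-insertAt i y xs)) (x∙yz≈y∙xz x y _)

  row>0⇒<length : ∀ l i → 1 ≤ row l i → i < length l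
  row>0⇒<length (x ∷ xs) zero    _   = s≤s z≤n
  row>0⇒<length (x ∷ xs) (suc i) p>0 = s≤s (row>0⇒<length xs i p>0)

  row-deleteAt-< : ∀ i l {p} → p < i → row (deleteAt i l) p ≡ row l p
  row-deleteAt-< i       []       _         = refl
  row-deleteAt-< (suc i) (x ∷ xs) {zero}  _ = refl
  row-deleteAt-< (suc i) (x ∷ xs) {suc p} (s≤s p<i) = row-deleteAt-< i xs p<i

  row-deleteAt-≥ : ∀ i l {p} → i ≤ p → row (deleteAt i l) p ≡ row l (suc p)
  row-deleteAt-≥ i       []       _ = refl
  row-deleteAt-≥ zero    (x ∷ xs) _ = refl
  row-deleteAt-≥ (suc i) (x ∷ xs) {suc p} (s≤s i≤p) = row-deleteAt-≥ i xs i≤p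

  row-insertAt-≡ : ∀ i y l → i ≤ length l → row (insertAt i y l) i ≡ y
  row-insertAt-≡ zero    y l        _         = refl
  row-insertAt-≡ (suc i) y (x ∷ xs) (s≤s i≤n) = row-insertAt-≡ i y xs i≤n

  row-insertAt-< : ∀ i y l {p} → i ≤ length l → p < i → row (insertAt i y l) p ≡ row l p
  row-insertAt-< (suc i) y (x ∷ xs) {zero}  _         _         = refl
  row-insertAt-< (suc i) y (x ∷ xs) {suc p} (s≤s i≤n) (s≤s p<i) = row-insertAt-< i y xs i≤n p<i

  row-insertAt-> : ∀ i y l {p} → i ≤ p → row (insertAt i y l) (suc p) ≡ row l p
  row-insertAt-> zero    y l        _ = refl
  row-insertAt-> (suc i) y []       {suc p} _ = refl
  row-insertAt-> (suc i) y (x ∷ xs) {suc p} (s≤s i≤p) = row-insertAt-> i y xs i≤p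

  All-≤-sum : ∀ l → All (_≤ sum l) l
  All-≤-sum []       = []
  All-≤-sum (x ∷ xs) =
    ℕ.m≤m+n x (sum xs) ∷ All.map (λ y≤ → ℕ.≤-trans y≤ (ℕ.m≤n+m (sum xs) x)) (All-≤-sum xs)

  row-≤ : ∀ l p → All (_≤ y) l → row l p ≤ y
  row-≤ []       p       _          = z≤n
  row-≤ (x ∷ xs) zero    (x≤ ∷ _)   = x≤
  row-≤ (x ∷ xs) (suc p) (_ ∷ xs≤) = row-≤ xs p xs≤

  row-≤-sum : ∀ l p → row l p ≤ sum l
  row-≤-sum l p = row-≤ l p (All-≤-sum l)

  Linked-≥-head : ∀ {xs} → Linked _≥_ (x ∷ xs) → All (_≤ x) xs
  Linked-≥-head {xs = []}    _   = []
  Linked-≥-head {xs = _ ∷ _} dec = Linked⇒All (flip ℕ.≤-trans) (Linked.head dec) (Linked.tail dec)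

  Linked-≥-cons : ∀ {xs} → All (_≤ x) xs → Linked _≥_ xs → Linked _≥_ (x ∷ xs)
  Linked-≥-cons {xs = []}    _          _   = [-]
  Linked-≥-cons {xs = _ ∷ _} (y≤x ∷ _) dec = y≤x ∷ dec

  row-antitone : ∀ l {p q} → Linked _≥_ l → p ≤ q → row l q ≤ row l p
  row-antitone []       _   _ = z≤n
  row-antitone (x ∷ xs) {zero}  {zero}  _   _ = ℕ.≤-refl
  row-antitone (x ∷ xs) {zero}  {suc q} dec _ = row-≤ xs q (Linked-≥-head dec)
  row-antitone (x ∷ xs) {suc p} {suc q} dec (s≤s p≤q) = row-antitone xs (Linked.tail dec) p≤q

  Linked-deleteAt : ∀ i l → Linked _≥_ l → Linked _≥_ (deleteAt i l)
  Linked-deleteAt i       []       _   = []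
  Linked-deleteAt zero    (x ∷ xs) dec = Linked.tail dec
  Linked-deleteAt (suc i) (x ∷ xs) dec =
    Linked-≥-cons (All-deleteAt i (Linked-≥-head dec)) (Linked-deleteAt i xs (Linked.tail dec))

  Linked-insertAt : ∀ i y l → Linked _≥_ l → row l i ≤ y → (∀ p → p < i → y ≤ row l p)
    → Linked _≥_ (insertAt i y l)
  Linked-insertAt zero    y []       _   _   _     = [-]
  Linked-insertAt zero    y (x ∷ xs) dec x≤y _     =
    Linked-≥-cons (x≤y ∷ All.map (λ z≤x → ℕ.≤-trans z≤x x≤y) (Linked-≥-head dec)) dec
  Linked-insertAt (suc i) y []       _   _   _     = [-]
  Linked-insertAt (suc i) y (x ∷ xs) dec r≤y y≤pre =
    Linked-≥-cons (All-insertAt i (y≤pre 0 (s≤s z≤n)) (Linked-≥-head dec))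
      (Linked-insertAt i y xs (Linked.tail dec) r≤y (λ p p<i → y≤pre (suc p) (s≤s p<i)))

  insertionIndex : ℕ → List ℕ → ℕ
  insertionIndex k []       = 0
  insertionIndex k (x ∷ xs) with k ≤? x
  ... | yes _ = suc (insertionIndex k xs)
  ... | no  _ = 0

  insertionIndex-≤-length : ∀ k l → insertionIndex k l ≤ length l
  insertionIndex-≤-length k []       = z≤n
  insertionIndex-≤-length k (x ∷ xs) with k ≤? x
  ... | yes _ = s≤s (insertionIndex-≤-length k xs)
  ... | no  _ = z≤n

  insertionIndex-prefix : ∀ k l p → p < insertionIndex k l → k ≤ row l p
  insertionIndex-prefix k (x ∷ xs) p p< with k ≤? x
  insertionIndex-prefix k (x ∷ xs) zero    _         | yes k≤x = k≤x
  insertionIndex-prefix k (x ∷ xs) (suc p) (s≤s p<) | yes _   = insertionIndex-prefix k xs p p<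

  row-insertionIndex : ∀ k l → 1 ≤ k → row l (insertionIndex k l) < k
  row-insertionIndex k []       k>0 = k>0
  row-insertionIndex k (x ∷ xs) k>0 with k ≤? x
  ... | yes _   = row-insertionIndex k xs k>0
  ... | no  k≰x = ℕ.≰⇒> k≰x

  insertionIndex-unique : ∀ k l q → 1 ≤ k → (∀ p → p < q → k ≤ row l p) → row l q < k
    → insertionIndex k l ≡ q
  insertionIndex-unique k       []       zero    _ _   _ = refl
  insertionIndex-unique (suc k) []       (suc q) _ pre _ with pre 0 (s≤s z≤n)
  ... | ()
  insertionIndex-unique k (x ∷ xs) zero _ _ x<k with k ≤? x
  ... | yes k≤x = ⊥-elim (ℕ.<⇒≱ x<k k≤x)
  ... | no  _   = refl
  insertionIndex-unique k (x ∷ xs) (suc q) k>0 pre r<k with k ≤? x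
  ... | yes _   = cong suc (insertionIndex-unique k xs q k>0 (λ p p<q → pre (suc p) (s≤s p<q)) r<k)
  ... | no  k≰x = ⊥-elim (k≰x (pre 0 (s≤s z≤n)))

  IsPartition-deleteAt : ∀ {n} i → IsPartition (k + n) l → row l i ≡ k → IsPartition n (deleteAt i l)
  IsPartition-deleteAt {l = l} i (Σl , pos , dec) r≡k =
    ℕ.+-cancelˡ-≡ _ _ _ (trans (cong (_+ sum (deleteAt i l)) (sym r≡k)) (trans (sym (sum-deleteAt i l)) Σl)) ,
    All-deleteAt i pos ,
    Linked-deleteAt i l dec

  IsPartition-insertAt : ∀ {n} i → 1 ≤ k → IsPartition n l → Linked _≥_ (insertAt i k l)
    → IsPartition (k + n) (insertAt i k l)
  IsPartition-insertAt {k = k} {l = l} i k>0 (Σl , pos , _) dec =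
    trans (sum-insertAt i k l) (cong (λ s → k + s) Σl) , All-insertAt i k>0 pos , dec

module BoundedPartitions where

  open Rows using (Linked-≥-head; Linked-≥-cons)
  open Counting using (length-≡-by-members)
  open import Data.Nat as ℕ using (ℕ; zero; suc; _+_; _∸_; _≤_; z≤n; s≤s; _≤?_; _≟_)
  import Data.Nat.Properties as ℕ
  open import Data.Nat.ListAction using (sum)
  open import Data.List using (List; []; _∷_; length; map; _++_)
  open import Data.List.Properties using (∷-injectiveʳ)
  open import Data.List.Membership.Propositional using (_∈_)
  open import Data.List.Membership.Propositional.Properties using (∈-map⁺; ∈-map⁻; ∈-++⁺ˡ; ∈-++⁺ʳ; ∈-++⁻)
  open import Data.List.Relation.Unary.Any using (here)
  open import Data.List.Relation.Unary.All as All using (All; []; _∷_)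
  import Data.List.Relation.Unary.Linked as Linked
  open import Data.List.Relation.Unary.Unique.Propositional using (Unique)
  open import Data.List.Relation.Unary.AllPairs using ([]; _∷_)
  import Data.List.Relation.Unary.Unique.Propositional.Properties as Unique
  open import Data.Product using (_×_; _,_)
  open import Data.Sum using (inj₁; inj₂)
  open import Data.Empty using (⊥)
  open import Function.Bundles using (mk⇔)
  open import Relation.Binary.PropositionalEquality
  open import Relation.Nullary using (Dec; yes; no)

  private variable
    A P : Set
    x : A
    xs : List A
    l : List ℕ
    N : ℕ

  keepIf : Dec P → List A → List A
  keepIf (yes _) xs = xs
  keepIf (no  _) _  = []

  ∈-keepIf⁻ : (d : Dec P) → x ∈ keepIf d xs → P × x ∈ xs
  ∈-keepIf⁻ (yes p) x∈ = p , x∈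

  ∈-keepIf⁺ : (d : Dec P) → P → x ∈ xs → x ∈ keepIf d xs
  ∈-keepIf⁺ (yes _) _ x∈ = x∈
  ∈-keepIf⁺ (no ¬p) p _  with () ← ¬p p

  keepIf-unique : (d : Dec P) → Unique xs → Unique (keepIf d xs)
  keepIf-unique (yes _) xs! = xs!
  keepIf-unique (no  _) _   = []

  BoundedPartition : ℕ → ℕ → List ℕ → Set
  BoundedPartition m N l = IsPartition N l × All (_≤ m) l

  emptyPartition : ℕ → List (List ℕ)
  emptyPartition zero    = [] ∷ []
  emptyPartition (suc _) = []

  -- Split on whether the largest part equals m; the fuel f ≥ N only makes the recursion structural.
  boundedPartitions : (f m N : ℕ) → List (List ℕ)
  boundedPartitions zero    _       N = emptyPartition N
  boundedPartitions (suc f) zero    N = emptyPartition N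
  boundedPartitions (suc f) (suc m) N =
    boundedPartitions (suc f) m N ++
    keepIf (suc m ≤? N) (map (suc m ∷_) (boundedPartitions f (suc m) (N ∸ suc m)))

  emptyPartition-sound : ∀ {m} → l ∈ emptyPartition N → BoundedPartition m N l
  emptyPartition-sound {N = zero} (here refl) = (refl , [] , Linked.[]) , []

  emptyPartition-complete : 0 ≡ N → [] ∈ emptyPartition N
  emptyPartition-complete refl = here refl

  emptyPartition-unique : ∀ N → Unique (emptyPartition N)
  emptyPartition-unique zero    = [] ∷ []
  emptyPartition-unique (suc N) = []

  positive∧sum≡0⇒[] : All (1 ≤_) l → sum l ≡ 0 → l ≡ []
  positive∧sum≡0⇒[] []          _  = refl
  positive∧sum≡0⇒[] (s≤s _ ∷ _) ()

  positive∧≤0⇒[] : All (1 ≤_) l → All (_≤ 0) l → l ≡ []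
  positive∧≤0⇒[] []          _        = refl
  positive∧≤0⇒[] (s≤s _ ∷ _) (() ∷ _)

  boundedPartitions-sound : ∀ f m N → l ∈ boundedPartitions f m N → BoundedPartition m N l
  boundedPartitions-sound zero    m       N l∈ = emptyPartition-sound l∈
  boundedPartitions-sound (suc f) zero    N l∈ = emptyPartition-sound l∈
  boundedPartitions-sound (suc f) (suc m) N l∈ with ∈-++⁻ (boundedPartitions (suc f) m N) l∈
  ... | inj₁ l∈′ with boundedPartitions-sound (suc f) m N l∈′
  ...   | P , ≤m = P , All.map ℕ.m≤n⇒m≤1+n ≤m
  boundedPartitions-sound (suc f) (suc m) N l∈ | inj₂ l∈′ with ∈-keepIf⁻ (suc m ≤? N) l∈′
  ...   | m<N , l∈″ with ∈-map⁻ (suc m ∷_) l∈″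
  ...     | t , t∈ , refl with boundedPartitions-sound f (suc m) (N ∸ suc m) t∈
  ...       | (Σt , pos , dec) , ≤m =
    (trans (cong (λ s → suc m + s) Σt) (ℕ.m+[n∸m]≡n m<N) , s≤s z≤n ∷ pos , Linked-≥-cons ≤m dec) ,
    ℕ.≤-refl ∷ ≤m

  boundedPartitions-complete : ∀ f m N → N ≤ f → BoundedPartition m N l → l ∈ boundedPartitions f m N
  boundedPartitions-complete zero m N N≤0 ((ΣN , pos , _) , _)
    with refl ← positive∧sum≡0⇒[] pos (trans ΣN (ℕ.n≤0⇒n≡0 N≤0)) = emptyPartition-complete ΣN
  boundedPartitions-complete (suc f) zero N _ ((ΣN , pos , _) , ≤0)
    with refl ← positive∧≤0⇒[] pos ≤0 = emptyPartition-complete ΣN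
  boundedPartitions-complete (suc f) (suc m) N N≤f (P , []) =
    ∈-++⁺ˡ (boundedPartitions-complete (suc f) m N N≤f (P , []))
  boundedPartitions-complete {l = h ∷ t} (suc f) (suc m) N N≤f (P@(ΣN , pos , dec) , h≤ ∷ ≤m)
    with h ≟ suc m
  ... | no h≢ = ∈-++⁺ˡ (boundedPartitions-complete (suc f) m N N≤f (P , h≤m ∷ t≤m))
    where
    h≤m : h ≤ m
    h≤m = ℕ.≤-pred (ℕ.≤∧≢⇒< h≤ h≢)
    t≤m : All (_≤ m) t
    t≤m = All.map (λ z≤h → ℕ.≤-trans z≤h h≤m) (Linked-≥-head dec)
  ... | yes refl = ∈-++⁺ʳ (boundedPartitions (suc f) m N) (∈-keepIf⁺ (suc m ≤? N) m<N
        (∈-map⁺ (suc m ∷_) (boundedPartitions-complete f (suc m) (N ∸ suc m) fuel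
          ((Σt , All.tail pos , Linked.tail dec) , ≤m))))
    where
    m<N : suc m ≤ N
    m<N = subst (suc m ≤_) ΣN (ℕ.m≤m+n (suc m) (sum t))
    Σt : sum t ≡ N ∸ suc m
    Σt = trans (sym (ℕ.m+n∸m≡n (suc m) (sum t))) (cong (_∸ suc m) ΣN)
    fuel : N ∸ suc m ≤ f
    fuel = ℕ.≤-trans (ℕ.∸-monoˡ-≤ (suc m) N≤f) (ℕ.m∸n≤m f m)

  boundedPartitions-unique : ∀ f m N → Unique (boundedPartitions f m N)
  boundedPartitions-unique zero    _       N = emptyPartition-unique N
  boundedPartitions-unique (suc f) zero    N = emptyPartition-unique N
  boundedPartitions-unique (suc f) (suc m) N =
    Unique.++⁺ (boundedPartitions-unique (suc f) m N)
      (keepIf-unique (suc m ≤? N) (Unique.map⁺ ∷-injectiveʳ (boundedPartitions-unique f (suc m) _)))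
      disjoint
    where
    disjoint : ∀ {l} → l ∈ boundedPartitions (suc f) m N
      × l ∈ keepIf (suc m ≤? N) (map (suc m ∷_) (boundedPartitions f (suc m) (N ∸ suc m))) → ⊥
    disjoint (l∈ , l∈′) with ∈-keepIf⁻ (suc m ≤? N) l∈′
    ... | _ , l∈″ with ∈-map⁻ (suc m ∷_) l∈″
    ...   | _ , _ , refl with boundedPartitions-sound (suc f) m N l∈
    ...     | _ , (m+1≤m ∷ _) = ℕ.<-irrefl refl m+1≤m

  partitionCount : ℕ → ℕ → ℕ
  partitionCount m N = length (boundedPartitions N m N)

  partitionCount-fuel : ∀ f m N → N ≤ f → length (boundedPartitions f m N) ≡ partitionCount m N
  partitionCount-fuel f m N N≤f =
    length-≡-by-members (boundedPartitions-unique f m N) (boundedPartitions-unique N m N)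
      (mk⇔ (λ l∈ → boundedPartitions-complete N m N ℕ.≤-refl (boundedPartitions-sound f m N l∈))
           (λ l∈ → boundedPartitions-complete f m N N≤f (boundedPartitions-sound N m N l∈)))

module MarkedRows (c d : ℕ) (L : ℕ → List (List ℕ × (ℕ × ℕ)))
    (L-unique : ∀ n → Unique (L n))
    (L-members : ∀ n x → (x ∈ L n) ⇔ M₂Pair c d n x) where

  open import Data.Nat as ℕ using (ℕ; suc; _+_; _∸_; _≤_; _<_; _≥_; z≤n; s≤s; _≟_)
  import Data.Nat.Properties as ℕ
  open import Data.List using (List; []; length)
  open import Data.List.Membership.Propositional using (_∈_)
  open import Data.List.Relation.Unary.All using (All)
  open import Data.List.Relation.Unary.Linked using (Linked)
  open import Data.List.Relation.Unary.Unique.Propositional using (Unique)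
  open import Data.List.Relation.Unary.AllPairs using ([])
  open import Data.Product using (_×_; _,_; proj₁)
  open import Data.Sum using (_⊎_; inj₁; inj₂)
  open import Data.Empty using (⊥; ⊥-elim)
  open import Function.Bundles using (_⇔_; mk⇔; Equivalence)
  open import Relation.Binary.PropositionalEquality
  open import Relation.Nullary using (yes; no)
  open Rows
  open Counting
  open BoundedPartitions

  k : ℕ
  k = suc (c + d)

  k>0 : 1 ≤ k
  k>0 = s≤s z≤n

  Marked : Set
  Marked = List ℕ × (ℕ × ℕ)

  toM₂ : ∀ {n x} → x ∈ L n → M₂Pair c d n x
  toM₂ {n} {x} = Equivalence.to (L-members n x)

  fromM₂ : ∀ {n x} → M₂Pair c d n x → x ∈ L n
  fromM₂ {n} {x} = Equivalence.from (L-members n x)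

  record RowOfLengthK (n : ℕ) (l : List ℕ) (i j : ℕ) : Set where
    constructor rowOfLengthK
    field
      i′        : ℕ
      i≡1+i′    : i ≡ suc i′
      j≡1+d     : j ≡ suc d
      row≡k     : row l i′ ≡ k
      partition : IsPartition n l

  M₂⇒row : ∀ {n l i j} → M₂Pair c d n (l , (i , j)) → RowOfLengthK n l i j
  M₂⇒row {i = suc i′} {j = suc j′} (P , (s≤s z≤n , s≤s z≤n , j≤) , arm , refl) =
    rowOfLengthK i′ refl refl
      (trans (sym (ℕ.m∸n+n≡m j≤)) (trans (cong (_+ suc j′) arm) (ℕ.+-suc c j′))) P

  row⇒M₂ : ∀ {n l i′} → IsPartition n l → row l i′ ≡ k → M₂Pair c d n (l , (suc i′ , suc d))
  row⇒M₂ P r≡k =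
    P ,
    (s≤s z≤n , s≤s z≤n , subst (suc d ≤_) (sym r≡k) (s≤s (ℕ.m≤n+m d c))) ,
    trans (cong (_∸ suc d) r≡k) (ℕ.m+n∸n≡m c d) ,
    refl

  -- The mark is in row i (1-indexed), so row l i is the row below it.
  split : Marked → Marked ⊎ List ℕ
  split (l , (i , j)) with row l i ≟ k
  ... | yes _ = inj₁ (deleteAt i l , (i , j))
  ... | no  _ = inj₂ (deleteAt (i ∸ 1) l)

  merge : Marked ⊎ List ℕ → Marked
  merge (inj₁ (l , (i , j))) = insertAt i k l , (i , j)
  merge (inj₂ ν)             = insertAt (insertionIndex k ν) k ν , (suc (insertionIndex k ν) , suc d)

  split-≡ : ∀ l i j → row l i ≡ k → split (l , (i , j)) ≡ inj₁ (deleteAt i l , (i , j))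
  split-≡ l i j r≡k with row l i ≟ k
  ... | yes _   = refl
  ... | no  r≢k = ⊥-elim (r≢k r≡k)

  split-≢ : ∀ l i j → row l i ≢ k → split (l , (i , j)) ≡ inj₂ (deleteAt (i ∸ 1) l)
  split-≢ l i j r≢k with row l i ≟ k
  ... | yes r≡k = ⊥-elim (r≢k r≡k)
  ... | no  _   = refl

  module _ (N : ℕ) where

    Split : List (Marked ⊎ List ℕ)
    Split = tagged (L N) (boundedPartitions N N N)

    split∈ : ∀ {x} → x ∈ L (k + N) → split x ∈ Split
    split∈ {l , (i , j)} x∈ with M₂⇒row (toM₂ x∈)
    ... | rowOfLengthK i′ refl refl r≡k P with row l (suc i′) ≟ k
    ...   | yes r′≡k = inj₁∈tagged _ (fromM₂ (row⇒M₂ (IsPartition-deleteAt (suc i′) P r′≡k)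
              (trans (row-deleteAt-< (suc i′) l (ℕ.n<1+n i′)) r≡k)))
    ...   | no  _    = inj₂∈tagged (L N) (boundedPartitions-complete N N N ℕ.≤-refl
              (Pν , subst (λ s → All (_≤ s) (deleteAt i′ l)) (proj₁ Pν) (All-≤-sum (deleteAt i′ l))))
      where
      Pν : IsPartition N (deleteAt i′ l)
      Pν = IsPartition-deleteAt i′ P r≡k

    merge-split : ∀ {x} → x ∈ L (k + N) → merge (split x) ≡ x
    merge-split {l , (i , j)} x∈ with M₂⇒row (toM₂ x∈)
    ... | rowOfLengthK i′ refl refl r≡k (_ , _ , dec) with row l (suc i′) ≟ k
    ...   | yes r′≡k = cong (_, (suc i′ , suc d)) (insertAt-deleteAt (suc i′) l k>0 r′≡k)
    ...   | no  r′≢k = trans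
              (cong (λ q → insertAt q k (deleteAt i′ l) , (suc q , suc d)) index≡i′)
              (cong (_, (suc i′ , suc d)) (insertAt-deleteAt i′ l k>0 r≡k))
      where
      index≡i′ : insertionIndex k (deleteAt i′ l) ≡ i′
      index≡i′ = insertionIndex-unique k (deleteAt i′ l) i′ k>0
        (λ p p<i′ → subst (k ≤_) (sym (row-deleteAt-< i′ l p<i′))
                      (subst (_≤ row l p) r≡k (row-antitone l dec (ℕ.<⇒≤ p<i′))))
        (subst (_< k) (sym (row-deleteAt-≥ i′ l ℕ.≤-refl))
          (ℕ.≤∧≢⇒< (subst (row l (suc i′) ≤_) r≡k (row-antitone l dec (ℕ.n≤1+n i′))) r′≢k))

    merge∈ : ∀ {z} → z ∈ Split → merge z ∈ L (k + N)
    merge∈ z∈ with ∈-tagged⁻ (L N) (boundedPartitions N N N) z∈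
    merge∈ z∈ | inj₁ ((l , (i , j)) , refl , x∈) with M₂⇒row (toM₂ x∈)
    ... | rowOfLengthK i′ refl refl r≡k P@(_ , _ , dec) =
      fromM₂ (row⇒M₂ (IsPartition-insertAt (suc i′) k>0 P inserted-dec)
        (trans (row-insertAt-< (suc i′) k l (row>0⇒<length l i′ (subst (1 ≤_) (sym r≡k) k>0)) (ℕ.n<1+n i′)) r≡k))
      where
      inserted-dec : Linked _≥_ (insertAt (suc i′) k l)
      inserted-dec = Linked-insertAt (suc i′) k l dec
        (subst (row l (suc i′) ≤_) r≡k (row-antitone l dec (ℕ.n≤1+n i′)))
        (λ p p≤i′ → subst (_≤ row l p) r≡k (row-antitone l dec (ℕ.≤-pred p≤i′)))
    merge∈ z∈ | inj₂ (ν , refl , ν∈) with boundedPartitions-sound N N N ν∈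
    ... | P@(_ , _ , dec) , _ =
      fromM₂ (row⇒M₂ (IsPartition-insertAt index k>0 P inserted-dec)
        (row-insertAt-≡ index k ν (insertionIndex-≤-length k ν)))
      where
      index : ℕ
      index = insertionIndex k ν
      inserted-dec : Linked _≥_ (insertAt index k ν)
      inserted-dec = Linked-insertAt index k ν dec (ℕ.<⇒≤ (row-insertionIndex k ν k>0))
        (insertionIndex-prefix k ν)

    split-merge : ∀ {z} → z ∈ Split → split (merge z) ≡ z
    split-merge z∈ with ∈-tagged⁻ (L N) (boundedPartitions N N N) z∈
    split-merge z∈ | inj₁ ((l , (i , j)) , refl , x∈) with M₂⇒row (toM₂ x∈)
    ... | rowOfLengthK i′ refl refl r≡k _ =
      trans (split-≡ (insertAt (suc i′) k l) (suc i′) (suc d) (row-insertAt-≡ (suc i′) k l i′<length))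
        (cong (λ l′ → inj₁ (l′ , (suc i′ , suc d))) (deleteAt-insertAt (suc i′) k l i′<length))
      where
      i′<length : suc i′ ≤ length l
      i′<length = row>0⇒<length l i′ (subst (1 ≤_) (sym r≡k) k>0)
    split-merge z∈ | inj₂ (ν , refl , _) =
      trans (split-≢ (insertAt index k ν) (suc index) (suc d) row≢k)
        (cong inj₂ (deleteAt-insertAt index k ν (insertionIndex-≤-length k ν)))
      where
      index : ℕ
      index = insertionIndex k ν
      row≢k : row (insertAt index k ν) (suc index) ≢ k
      row≢k r≡k = ℕ.<-irrefl r≡k
        (subst (_< k) (sym (row-insertAt-> index k ν ℕ.≤-refl)) (row-insertionIndex k ν k>0))

    count-+ : length (L (k + N)) ≡ length (L N) + partitionCount N N
    count-+ = trans
      (length-≡-by-inverses split merge (L-unique (k + N))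
        (tagged-unique (L-unique N) (boundedPartitions-unique N N N))
        split∈ merge∈ merge-split split-merge)
      (length-tagged (L N) (boundedPartitions N N N))

  count-< : ∀ n → n < k → length (L n) ≡ 0
  count-< n n<k = length-≡-by-members (L-unique n) [] (mk⇔ (λ x∈ → ⊥-elim (no-cell x∈)) λ ())
    where
    no-cell : ∀ {x} → x ∈ L n → ⊥
    no-cell {l , (i , j)} x∈ with M₂⇒row (toM₂ x∈)
    ... | rowOfLengthK i′ refl refl r≡k (Σl , _ , _) =
      ℕ.<⇒≱ n<k (subst (k ≤_) Σl (subst (_≤ _) r≡k (row-≤-sum l i′)))

open PowerSeries
open BoundedPartitions using (keepIf; boundedPartitions; partitionCount; partitionCount-fuel)

open import Data.Nat as ℕ using (zero; _≤_; _∸_; s≤s; _≤?_)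
import Data.Nat.Properties as ℕ
open import Data.Integer using (_+_)
open import Data.List using (map; _∷_)
open import Data.List.Properties using (length-++; length-map)
open import Relation.Binary.PropositionalEquality using (_≗_; refl; sym; trans; cong; module ≡-Reasoning)
open import Relation.Nullary using (Dec; yes; no)

partitionSeries : ℕ → Series
partitionSeries m n = + partitionCount m n

partitionSeries-zero : partitionSeries 0 ≗ one
partitionSeries-zero zero    = refl
partitionSeries-zero (suc n) = refl

partitionSeries-suc : ∀ m n → partitionSeries (suc m) n ≡ partitionSeries m n + shift (suc m) (partitionSeries (suc m)) n
partitionSeries-suc m zero    = refl
partitionSeries-suc m (suc n) =
  trans (cong +_ (length-++ (boundedPartitions (suc n) m (suc n))))
        (cong (λ x → partitionSeries m (suc n) + x) (largestPart≡1+m (suc m ≤? suc n)))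
  where
  largestPart≡1+m : (d : Dec (suc m ≤ suc n))
    → + length (keepIf d (map (suc m ∷_) (boundedPartitions n (suc m) (n ∸ m))))
      ≡ shift (suc m) (partitionSeries (suc m)) (suc n)
  largestPart≡1+m (yes (s≤s m≤n)) = trans
    (cong +_ (trans (length-map (suc m ∷_) (boundedPartitions n (suc m) (n ∸ m))) (partitionCount-fuel n (suc m) (n ∸ m) (ℕ.m∸n≤m n m))))
    (sym (shift-≥ m (partitionSeries (suc m)) m≤n))
  largestPart≡1+m (no m≰n) = sym (shift-< (suc m) _ (ℕ.≰⇒> m≰n))

lemma2 : (c d : ℕ) (L : ℕ → List (List ℕ × (ℕ × ℕ)))
    → (∀ n → Unique (L n))
    → (∀ n x → (x ∈ L n) ⇔ M₂Pair c d n x)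
    → ∀ n → (((λ m → + length (L m)) ⋆ oneMinus (suc (c +ℕ d))) ⋆ qInf) n
            ≡ mono (suc (c +ℕ d)) n
lemma2 c d L L-unique L-members n = begin
  ((A ⋆ oneMinus k) ⋆ qInf) n   ≡⟨ ⋆-congˡ qInf (⋆-oneMinus-recurrence k (shift k P) (shift-recurrence k A P A-< A-+)) n ⟩
  (shift k P ⋆ qInf) n          ≡⟨ ⋆-shiftˡ k P qInf n ⟩
  shift k (P ⋆ qInf) n          ≡⟨ shift-cong k (diagonal⋆qInf partitionSeries partitionSeries-zero p-suc) n ⟩
  shift k one n                 ≡⟨ mono≗shift-one k n ⟨
  mono k n                      ∎
  where
  open ≡-Reasoning
  open MarkedRows c d L L-unique L-members
  A P : Series
  A m = + length (L m)
  P t = partitionSeries t t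
  A-< : ∀ m → m ℕ.< k → A m ≡ + 0
  A-< m m<k = cong +_ (count-< m m<k)
  A-+ : ∀ N → A (k +ℕ N) ≡ A N + P N
  A-+ N = cong +_ (count-+ N)
  p-suc : ∀ m → partitionSeries (suc m) ⋆ oneMinus (suc m) ≗ partitionSeries m
  p-suc m = ⋆-oneMinus-recurrence (suc m) (partitionSeries m) (partitionSeries-suc m)
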